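{- The statistic $\mathrm{Stat}_{123}(\sigma)=\mathrm{inv}(\sigma)-\mathrm{inv}(\Phi_{321}(\sigma))$ on permutations exhibits the cyclic sieving phenomenon under involutions with $1$ fixed point when $n=0$ and $2^{n-1}$ fixed points for all $n\ge1$.
   Context: $\mathfrak{S}_n$ is the set of permutations $\sigma=\sigma_1\cdots\sigma_n$ of $[n]$; $\mathrm{inv}(\sigma)=\#\{(i,j):i<j,\ \sigma_i>\sigma_j\}$. A position $i$ is a left-to-right maximum if $\sigma_i>\sigma_j$ for all $j<i$. The Simion–Schmidt map $\Phi_{321}$ keeps the entries at positions of left-to-right maxima fixed and places the remaining entries in increasing order into the remaining positions. Cyclic sieving for involutions: for an involution $\phi$ on a finite set $X$ and polynomial $f$, $(X,\{\mathrm{id},\phi\},f)$ exhibits the CSP iff $f(1)=|X|$ and $f(-1)$ equals the number of fixed points of $\phi$. A statistic exhibits the CSP under involutions with $a_n$ fixed points if for every $n\ge0$ and every involution $\phi$ of $\mathfrak{S}_n$ with exactly $a_n$ fixed points, $(\mathfrak{S}_n,\{\mathrm{id},\phi\},\sum_{\sigma\in\mathfrak{S}_n}q^{\mathrm{stat}(\sigma)})$ exhibits the CSP. -}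

module Defs where

open import Data.Bool using (Bool; true; false; T; not; _∧_; if_then_else_)
open import Data.Bool.Properties using (T?; T-irrelevant)
open import Data.Nat using (ℕ; zero; suc; _∸_; _<ᵇ_; _^_)
open import Data.Nat.Properties using (≤-decTotalOrder)
open import Data.Integer using (ℤ; +_) renaming (_^_ to _^ℤ_; _+_ to _+ℤ_)
open import Data.Fin using (Fin; toℕ)
import Data.Fin as F
open import Data.List using (List; []; _∷_; [_]; length; filter; map; concatMap; mapMaybe; allFin; foldr)
open import Data.Bool.ListAction using (any)
open import Data.Vec using (Vec; toList) renaming ([] to []ᵛ; _∷_ to _∷ᵛ_)
open import Data.Vec.Properties using (≡-dec)
open import Data.Maybe using (Maybe; just; nothing)
open import Data.Product using (Σ; _,_; proj₁; _×_)
open import Relation.Nullary using (yes; no; Dec)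
open import Relation.Nullary.Decidable using (⌊_⌋)
open import Relation.Binary.PropositionalEquality using (_≡_; refl; cong)
open import Relation.Binary.Definitions using (DecidableEquality)
open import Data.List.Sort.InsertionSort.Base ≤-decTotalOrder using (sort)

-- Permutations of [n] as words σ₁⋯σₙ over Fin n with distinct letters
-- (letter k : Fin n stands for the value k+1 ∈ [n]).

distinct : ∀ {n} → List (Fin n) → Bool
distinct []       = true
distinct (x ∷ xs) = not (any (λ y → ⌊ x F.≟ y ⌋) xs) ∧ distinct xs

isPerm : ∀ {n} → Vec (Fin n) n → Bool
isPerm v = distinct (toList v)

Perm : ℕ → Set
Perm n = Σ (Vec (Fin n) n) (λ v → T (isPerm v))

_≟P_ : ∀ {n} → DecidableEquality (Perm n)
(v , p) ≟P (w , q) with ≡-dec F._≟_ v w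
... | yes refl = yes (cong (v ,_) (T-irrelevant p q))
... | no v≢w   = no (λ { refl → v≢w refl })

words : ∀ n k → List (Vec (Fin n) k)
words n zero    = [ []ᵛ ]
words n (suc k) = concatMap (λ i → map (i ∷ᵛ_) (words n k)) (allFin n)

toPerm : ∀ {n} → Vec (Fin n) n → Maybe (Perm n)
toPerm v with T? (isPerm v)
... | yes p = just (v , p)
... | no _  = nothing

allPerms : ∀ n → List (Perm n)
allPerms n = mapMaybe toPerm (words n n)

oneLine : ∀ {n} → Perm n → List ℕ
oneLine (v , _) = Data.List.map toℕ (toList v)

inv : List ℕ → ℕ
inv []       = 0
inv (x ∷ xs) = length (filter (λ y → Data.Nat._<?_ y x) xs) Data.Nat.+ inv xs

-- lrMaxMask xs: i-th entry is true iff position i is a left-to-right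
-- maximum (σᵢ > σⱼ for all j < i).  The argument 'm' is the maximum of
-- the prefix read so far (nothing for the empty prefix).
lrMaxMask : Maybe ℕ → List ℕ → List Bool
lrMaxMask m        []       = []
lrMaxMask nothing  (x ∷ xs) = true ∷ lrMaxMask (just x) xs
lrMaxMask (just m) (x ∷ xs) with m <ᵇ x
... | true  = true  ∷ lrMaxMask (just x) xs
... | false = false ∷ lrMaxMask (just m) xs

nonLR : List Bool → List ℕ → List ℕ
nonLR (b ∷ bs) (x ∷ xs) = if b then nonLR bs xs else x ∷ nonLR bs xs
nonLR _        _        = []

fill : List Bool → List ℕ → List ℕ → List ℕ
fill (true  ∷ bs) (x ∷ xs) ys       = x ∷ fill bs xs ys
fill (false ∷ bs) (x ∷ xs) (y ∷ ys) = y ∷ fill bs xs ys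
fill _            _        _        = []

Φ321 : List ℕ → List ℕ
Φ321 xs = fill mask xs (sort (nonLR mask xs))
  where mask = lrMaxMask nothing xs

-- Stat₁₂₃(σ) = inv(σ) − inv(Φ₃₂₁(σ))   (always ≥ 0)
Stat123 : ∀ {n} → Perm n → ℕ
Stat123 σ = inv (oneLine σ) ∸ inv (Φ321 (oneLine σ))

genPoly : ∀ {X : Set} → List X → (X → ℕ) → ℤ → ℤ
genPoly xs stat q = foldr (λ x acc → (q ^ℤ stat x) +ℤ acc) (+ 0) xs

fixedPoints : ∀ {X : Set} → DecidableEquality X → List X → (X → X) → ℕ
fixedPoints _≟_ xs φ = length (filter (λ x → φ x ≟ x) xs)

-- (X, {id, φ}, f) exhibits the CSP: f(1) = |X| and f(-1) = #fixed points of φ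
CSP-inv : ∀ {X : Set} → DecidableEquality X → List X → (X → X) → (ℤ → ℤ) → Set
CSP-inv _≟_ xs φ f = (f (+ 1) ≡ + length xs) × (f (Data.Integer.- (+ 1)) ≡ + fixedPoints _≟_ xs φ)

aSeq : ℕ → ℕ
aSeq zero    = 1
aSeq (suc m) = 2 ^ m

ExhibitsCSPInv : (∀ {n} → Perm n → ℕ) → (ℕ → ℕ) → Set
ExhibitsCSPInv stat a =
  (n : ℕ) (φ : Perm n → Perm n) →
  (∀ σ → φ (φ σ) ≡ σ) →
  fixedPoints _≟P_ (allPerms n) φ ≡ a n →
  CSP-inv _≟P_ (allPerms n) φ (genPoly (allPerms n) stat)

-- A left-to-right maximum x of σ exceeds every earlier entry, and the later entries below x are the
-- non-maxima below x except those placed before x. Φ₃₂₁(σ) has the same maxima in the same places, so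
-- x contributes equally many inversions to σ and to Φ₃₂₁(σ), whose non-maxima are sorted: Stat₁₂₃(σ)
-- is the number of inversions among the non-maxima of σ. Split f(−1) = Σ (−1)^Stat₁₂₃(σ) by the first
-- letter: the two smallest possible first letters each contribute the same sum for one letter fewer
-- (after exchanging the two smallest values in the second case), and any other first letter contributes
-- 0, because exchanging the values of the two smallest letters, both non-maxima, reverses the sign.
-- So f(−1) doubles with each letter and equals 2ⁿ⁻¹, while f(1) = |𝔖ₙ|.

module Submission where

open import Defs
open import Function using (_∘_; id)
open import Function.Definitions using (Injective)
open import Data.Bool using (Bool; true; false; T; not; _∧_; if_then_else_)
open import Data.Bool.Properties using (∧-assoc; ∧-zeroʳ; T?)
open import Data.Bool.ListAction using (all; any)
open import Data.Nat
open import Data.Nat.Properties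
open import Data.Integer using (ℤ; -[1+_]; 0ℤ; -1ℤ; -_)
  renaming (+_ to pos; _+_ to _+ℤ_; _*_ to _*ℤ_; _^_ to _^ℤ_)
import Data.Integer.Properties as ℤ
open import Algebra.Properties.CommutativeSemigroup +-commutativeSemigroup using (interchange; x∙yz≈y∙xz)
open import Algebra.Properties.CommutativeSemigroup ℤ.+-commutativeSemigroup as ℤ-Semigroup using ()
open import Data.Fin as Fin using (Fin; toℕ)
import Data.Fin.Properties as Fin
open import Data.Vec using (Vec; toList) renaming (_∷_ to _∷ᵛ_)
open import Data.List
  using (List; []; _∷_; _++_; length; filter; map; concatMap; mapMaybe; foldr; allFin; upTo; applyUpTo; tabulate)
open import Data.List.Properties
  using (filter-accept; filter-reject; filter-all; filter-none; map-tabulate; map-id-local; length-upTo)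
open import Data.List.Membership.Propositional using (_∈_; _∉_)
open import Data.List.Membership.DecPropositional _≟_ using (_∈?_; _∉?_)
open import Data.List.Relation.Unary.Any using (here; there)
open import Data.List.Relation.Unary.All as All using (All; []; _∷_)
import Data.List.Relation.Unary.All.Properties as All
open import Data.List.Relation.Unary.AllPairs as AllPairs using (AllPairs; []; _∷_)
import Data.List.Relation.Unary.AllPairs.Properties as AllPairs
open import Data.List.Relation.Unary.Unique.Propositional using (Unique)
import Data.List.Relation.Unary.Unique.Propositional.Properties as Unique
open import Data.List.Relation.Binary.Permutation.Propositional as ↭
  using (_↭_; ↭-refl; ↭-prep; ↭-swap; ↭-trans; ↭-sym; ↭-reflexive)
open import Data.List.Relation.Binary.Permutation.Propositional.Properties
  using (↭-length; filter-↭; All-resp-↭)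
open import Data.List.Sort.InsertionSort.Base ≤-decTotalOrder using (sort)
open import Data.List.Sort.InsertionSort.Properties ≤-decTotalOrder using (sort-↭; sort-↗)
open import Data.List.Relation.Unary.Sorted.TotalOrder.Properties using (Sorted⇒AllPairs)
open import Data.Maybe using (Maybe; just; nothing; maybe)
open import Data.Product using (_,_)
open import Data.Sum as Sum using (_⊎_; inj₁; inj₂)
open import Relation.Nullary using (¬_; Dec; yes; no; does; ¬?; contradiction)
open import Relation.Nullary.Decidable using (⌊_⌋; dec-true; dec-false)
open import Relation.Unary using (Decidable)
open import Relation.Binary.PropositionalEquality
open ≡-Reasoning

-- Inversions of Φ₃₂₁

count< : ℕ → List ℕ → ℕ
count< t xs = length (filter (_<? t) xs)

count≤ : ℕ → List ℕ → ℕ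
count≤ t xs = length (filter (_≤? t) xs)

count<-∷< : ∀ {t x} xs → x < t → count< t (x ∷ xs) ≡ suc (count< t xs)
count<-∷< xs x<t = cong length (filter-accept (_<? _) x<t)

count<-∷≥ : ∀ {t x} xs → t ≤ x → count< t (x ∷ xs) ≡ count< t xs
count<-∷≥ xs t≤x = cong length (filter-reject (_<? _) (≤⇒≯ t≤x))

count<-none : ∀ {t xs} → All (t ≤_) xs → count< t xs ≡ 0
count<-none {t} t≤xs = cong length (filter-none (_<? t) (All.map ≤⇒≯ t≤xs))

count<-∷ : ∀ t x {xs ys} → count< t xs ≡ count< t ys → count< t (x ∷ xs) ≡ count< t (x ∷ ys)
count<-∷ t x eq with does (x <? t)
... | true  = cong suc eq
... | false = eq

count≤-∷≤ : ∀ {t x} xs → x ≤ t → count≤ t (x ∷ xs) ≡ suc (count≤ t xs)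
count≤-∷≤ xs x≤t = cong length (filter-accept (_≤? _) x≤t)

count≤-none : ∀ {t xs} → All (t <_) xs → count≤ t xs ≡ 0
count≤-none {t} t<xs = cong length (filter-none (_≤? t) (All.map <⇒≱ t<xs))

length-filter-sort : ∀ {P : ℕ → Set} (P? : Decidable P) xs →
                     length (filter P? (sort xs)) ≡ length (filter P? xs)
length-filter-sort P? xs = ↭-length (filter-↭ P? (sort-↭ xs))

inv-sorted : ∀ {xs} → AllPairs _≤_ xs → inv xs ≡ 0
inv-sorted []           = refl
inv-sorted (x≤xs ∷ xs↗) = cong₂ _+_ (count<-none x≤xs) (inv-sorted xs↗)

lrMask : ℕ → List ℕ → List Bool
lrMask M = lrMaxMask (just M)

nonMaximaAfter : ℕ → List ℕ → List ℕ
nonMaximaAfter M xs = nonLR (lrMask M xs) xs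

nonMaxima : List ℕ → List ℕ
nonMaxima xs = nonLR (lrMaxMask nothing xs) xs

lrMask-max : ∀ {M x} xs → M < x → lrMask M (x ∷ xs) ≡ true ∷ lrMask x xs
lrMask-max {M} {x} xs M<x with M <ᵇ x | <⇒<ᵇ M<x
... | true | _ = refl

lrMask-nonmax : ∀ {M x} xs → x ≤ M → lrMask M (x ∷ xs) ≡ false ∷ lrMask M xs
lrMask-nonmax {M} {x} xs x≤M with M <ᵇ x | <ᵇ⇒< M x
... | false | _   = refl
... | true  | M<x = contradiction (M<x _) (≤⇒≯ x≤M)

nonMaximaAfter-max : ∀ {M x} xs → M < x → nonMaximaAfter M (x ∷ xs) ≡ nonMaximaAfter x xs
nonMaximaAfter-max xs M<x = cong (λ m → nonLR m (_ ∷ xs)) (lrMask-max xs M<x)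

nonMaximaAfter-nonmax : ∀ {M x} xs → x ≤ M → nonMaximaAfter M (x ∷ xs) ≡ x ∷ nonMaximaAfter M xs
nonMaximaAfter-nonmax xs x≤M = cong (λ m → nonLR m (_ ∷ xs)) (lrMask-nonmax xs x≤M)

-- Refill M xs ys: xs follows a prefix with maximum M, and writing ys in order into the positions of
-- xs that are not left-to-right maxima creates no new left-to-right maximum.
data Refill : ℕ → List ℕ → List ℕ → Set where
  done   : ∀ {M} → Refill M [] []
  keep   : ∀ {M x xs ys} → M < x → Refill x xs ys → Refill M (x ∷ xs) ys
  refill : ∀ {M x y xs ys} → x ≤ M → y ≤ M → Refill M xs ys → Refill M (x ∷ xs) (y ∷ ys)

nonMaximaAfter-refill : ∀ M xs → Refill M xs (nonMaximaAfter M xs)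
nonMaximaAfter-refill M []       = done
nonMaximaAfter-refill M (x ∷ xs) with <-≤-connex M x
... | inj₁ M<x rewrite lrMask-max xs M<x = keep M<x (nonMaximaAfter-refill x xs)
... | inj₂ x≤M rewrite lrMask-nonmax xs x≤M = refill x≤M x≤M (nonMaximaAfter-refill M xs)

fill-nonMaximaAfter : ∀ M xs → fill (lrMask M xs) xs (nonMaximaAfter M xs) ≡ xs
fill-nonMaximaAfter M []       = refl
fill-nonMaximaAfter M (x ∷ xs) with <-≤-connex M x
... | inj₁ M<x rewrite lrMask-max xs M<x = cong (x ∷_) (fill-nonMaximaAfter x xs)
... | inj₂ x≤M rewrite lrMask-nonmax xs x≤M = cong (x ∷_) (fill-nonMaximaAfter M xs)

sorted-refill : ∀ {M} xs {s} → AllPairs _≤_ s → length s ≡ length (nonMaximaAfter M xs) →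
                (∀ t → M ≤ t → count≤ t (nonMaximaAfter M xs) ≤ count≤ t s) → Refill M xs s
sorted-refill [] {[]} _ _ _ = done
sorted-refill {M} (x ∷ xs) s↗ len dom with <-≤-connex M x
... | inj₁ M<x = keep M<x (sorted-refill xs s↗ (trans len (cong length o≡))
                   (λ t x≤t → subst (λ o → count≤ t o ≤ _) o≡ (dom t (<⇒≤ (<-≤-trans M<x x≤t)))))
  where
  o≡ : nonMaximaAfter M (x ∷ xs) ≡ nonMaximaAfter x xs
  o≡ = nonMaximaAfter-max xs M<x
sorted-refill {M} (x ∷ xs) {[]} s↗ len dom | inj₂ x≤M =
  contradiction (trans len (cong length (nonMaximaAfter-nonmax xs x≤M))) λ ()
sorted-refill {M} (x ∷ xs) {h ∷ s} (h≤s ∷ s↗) len dom | inj₂ x≤M =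
  refill x≤M h≤M (sorted-refill xs s↗ (suc-injective (trans len (cong length o≡))) dom′)
  where
  o≡ : nonMaximaAfter M (x ∷ xs) ≡ x ∷ nonMaximaAfter M xs
  o≡ = nonMaximaAfter-nonmax xs x≤M
  dom-x : ∀ t → M ≤ t → suc (count≤ t (nonMaximaAfter M xs)) ≤ count≤ t (h ∷ s)
  dom-x t M≤t = subst (_≤ _) (count≤-∷≤ _ (≤-trans x≤M M≤t)) (subst (λ o → count≤ t o ≤ _) o≡ (dom t M≤t))
  h≤M : h ≤ M
  h≤M = ≮⇒≥ λ M<h → contradiction
          (subst (_ ≤_) (count≤-none (M<h ∷ All.map (<-≤-trans M<h) h≤s)) (dom-x M ≤-refl)) λ ()
  dom′ : ∀ t → M ≤ t → count≤ t (nonMaximaAfter M xs) ≤ count≤ t s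
  dom′ t M≤t = s≤s⁻¹ (subst (_ ≤_) (count≤-∷≤ s (≤-trans h≤M M≤t)) (dom-x t M≤t))

count<-fill : ∀ {M xs ys t} → Refill M xs ys → t ≤ M → count< t (fill (lrMask M xs) xs ys) ≡ count< t ys
count<-fill done _ = refl
count<-fill (keep {xs = xs} M<x f) t≤M rewrite lrMask-max xs M<x =
  trans (count<-∷≥ _ (≤-trans t≤M (<⇒≤ M<x))) (count<-fill f (≤-trans t≤M (<⇒≤ M<x)))
count<-fill {t = t} (refill {y = y} {xs} x≤M _ f) t≤M rewrite lrMask-nonmax xs x≤M =
  count<-∷ t y (count<-fill f t≤M)

-- Summed over the left-to-right maxima x marked by the mask: lrOffsets counts k plus the positions
-- before x that are not maxima, lrCrossings counts the entries of Y below x.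
lrOffsets : List Bool → ℕ → ℕ
lrOffsets []           k = 0
lrOffsets (true  ∷ bs) k = k + lrOffsets bs k
lrOffsets (false ∷ bs) k = lrOffsets bs (suc k)

lrCrossings : List Bool → List ℕ → List ℕ → ℕ
lrCrossings (true  ∷ bs) (x ∷ xs) Y = count< x Y + lrCrossings bs xs Y
lrCrossings (false ∷ bs) (x ∷ xs) Y = lrCrossings bs xs Y
lrCrossings _            _        Y = 0

-- A left-to-right maximum x has no inversion with earlier entries; its inversions are the refilled
-- entries below x that come after it, i.e. those of Y minus those already placed (k counts entries of
-- Y placed before xs). Adding lrOffsets on the left avoids truncated subtraction.
inv-fill : ∀ {M xs ys Y k} → Refill M xs ys → (∀ t → M < t → count< t Y ≡ k + count< t ys) →
           inv (fill (lrMask M xs) xs ys) + lrOffsets (lrMask M xs) k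
             ≡ inv ys + lrCrossings (lrMask M xs) xs Y
inv-fill done _ = refl
inv-fill {ys = ys} {Y} {k} (keep {x = x} {xs} M<x f) Y≡ rewrite lrMask-max xs M<x = begin
  count< x Z + inv Z + (k + lrOffsets m k)
    ≡⟨ cong (λ c → c + inv Z + (k + lrOffsets m k)) (count<-fill f ≤-refl) ⟩
  count< x ys + inv Z + (k + lrOffsets m k)
    ≡⟨ interchange (count< x ys) (inv Z) k (lrOffsets m k) ⟩
  (count< x ys + k) + (inv Z + lrOffsets m k)
    ≡⟨ cong₂ _+_ (trans (+-comm _ k) (sym (Y≡ x M<x))) (inv-fill f (λ t x<t → Y≡ t (<-trans M<x x<t))) ⟩
  count< x Y + (inv ys + lrCrossings m xs Y)
    ≡⟨ x∙yz≈y∙xz (count< x Y) (inv ys) _ ⟩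
  inv ys + (count< x Y + lrCrossings m xs Y) ∎
  where
  m = lrMask x xs
  Z = fill m xs ys
inv-fill {Y = Y} {k} (refill {y = y} {xs} {ys} x≤M y≤M f) Y≡ rewrite lrMask-nonmax xs x≤M = begin
  count< y Z + inv Z + lrOffsets m (suc k)
    ≡⟨ +-assoc (count< y Z) (inv Z) _ ⟩
  count< y Z + (inv Z + lrOffsets m (suc k))
    ≡⟨ cong₂ _+_ (count<-fill f y≤M) (inv-fill f Y≡′) ⟩
  count< y ys + (inv ys + lrCrossings m xs Y)
    ≡⟨ +-assoc (count< y ys) (inv ys) _ ⟨
  count< y ys + inv ys + lrCrossings m xs Y ∎
  where
  m = lrMask _ xs
  Z = fill m xs ys
  Y≡′ : ∀ t → _ < t → count< t Y ≡ suc k + count< t ys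
  Y≡′ t M<t = trans (Y≡ t M<t) (trans (cong (k +_) (count<-∷< ys (≤-<-trans y≤M M<t))) (+-suc k _))

inv≡inv-nonMaxima+inv-Φ321 : ∀ xs → inv xs ≡ inv (nonMaxima xs) + inv (Φ321 xs)
inv≡inv-nonMaxima+inv-Φ321 []       = refl
inv≡inv-nonMaxima+inv-Φ321 (x ∷ xs) = +-cancelʳ-≡ D _ _ (begin
  count< x xs + inv xs + D            ≡⟨ +-assoc (count< x xs) (inv xs) D ⟩
  count< x xs + (inv xs + D)          ≡⟨ cong₂ _+_ count<-xs inv-xs ⟩
  count< x o + (inv o + C)            ≡⟨ x∙yz≈y∙xz (count< x o) (inv o) C ⟩
  inv o + (count< x o + C)            ≡⟨ cong₂ (λ c d → inv o + (c + d)) count<-Φ inv-Φ ⟨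
  inv o + (count< x Φ + (inv Φ + D))  ≡⟨ cong (inv o +_) (+-assoc (count< x Φ) (inv Φ) D) ⟨
  inv o + ((count< x Φ + inv Φ) + D)  ≡⟨ +-assoc (inv o) _ D ⟨
  inv o + (count< x Φ + inv Φ) + D    ∎)
  where
  m = lrMask x xs
  o = nonMaximaAfter x xs
  Φ = fill m xs (sort o)
  D = lrOffsets m 0
  C = lrCrossings m xs o
  sort-o↗ : AllPairs _≤_ (sort o)
  sort-o↗ = Sorted⇒AllPairs ≤-totalOrder (sort-↗ o)
  o-refill : Refill x xs o
  o-refill = nonMaximaAfter-refill x xs
  sorted-o-refill : Refill x xs (sort o)
  sorted-o-refill = sorted-refill xs sort-o↗ (↭-length (sort-↭ o))
                      (λ t _ → ≤-reflexive (sym (length-filter-sort (_≤? t) o)))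
  count<-xs : count< x xs ≡ count< x o
  count<-xs = trans (sym (cong (count< x) (fill-nonMaximaAfter x xs))) (count<-fill o-refill ≤-refl)
  inv-xs : inv xs + D ≡ inv o + C
  inv-xs = subst (λ z → inv z + D ≡ inv o + C) (fill-nonMaximaAfter x xs) (inv-fill o-refill λ _ _ → refl)
  count<-Φ : count< x Φ ≡ count< x o
  count<-Φ = trans (count<-fill sorted-o-refill ≤-refl) (length-filter-sort (_<? x) o)
  inv-Φ : inv Φ + D ≡ C
  inv-Φ = trans (inv-fill sorted-o-refill (λ t _ → sym (length-filter-sort (_<? t) o)))
                (cong (_+ C) (inv-sorted sort-o↗))

inv∸inv-Φ321≡inv-nonMaxima : ∀ xs → inv xs ∸ inv (Φ321 xs) ≡ inv (nonMaxima xs)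
inv∸inv-Φ321≡inv-nonMaxima xs =
  trans (cong (_∸ inv (Φ321 xs)) (inv≡inv-nonMaxima+inv-Φ321 xs)) (m+n∸n≡m (inv (nonMaxima xs)) (inv (Φ321 xs)))

∑ : {X : Set} → List X → (X → ℤ) → ℤ
∑ xs f = foldr (λ x s → f x +ℤ s) 0ℤ xs

infix 5 ∑
syntax ∑ xs (λ x → e) = ∑[ x ∈ xs ] e

private variable X Y : Set

∑-cong : ∀ (xs : List X) {f g} → (∀ {x} → x ∈ xs → f x ≡ g x) → ∑ xs f ≡ ∑ xs g
∑-cong []       eq = refl
∑-cong (x ∷ xs) eq = cong₂ _+ℤ_ (eq (here refl)) (∑-cong xs (eq ∘ there))

∑-0 : ∀ (xs : List X) → ∑[ x ∈ xs ] 0ℤ ≡ 0ℤ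
∑-0 []       = refl
∑-0 (x ∷ xs) = trans (ℤ.+-identityˡ _) (∑-0 xs)

∑-neg : ∀ (xs : List X) f → ∑[ x ∈ xs ] - f x ≡ - ∑ xs f
∑-neg []       f = refl
∑-neg (x ∷ xs) f = trans (cong ((- f x) +ℤ_) (∑-neg xs f)) (sym (ℤ.neg-distrib-+ (f x) _))

∑-++ : ∀ (xs ys : List X) f → ∑ (xs ++ ys) f ≡ ∑ xs f +ℤ ∑ ys f
∑-++ []       ys f = sym (ℤ.+-identityˡ _)
∑-++ (x ∷ xs) ys f = trans (cong (f x +ℤ_) (∑-++ xs ys f)) (sym (ℤ.+-assoc (f x) _ _))

∑-↭ : ∀ {xs ys : List X} f → xs ↭ ys → ∑ xs f ≡ ∑ ys f
∑-↭ f ↭.refl         = refl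
∑-↭ f (↭.prep x p)   = cong (f x +ℤ_) (∑-↭ f p)
∑-↭ f (↭.swap x y p) = trans (cong (λ s → f x +ℤ (f y +ℤ s)) (∑-↭ f p)) (ℤ-Semigroup.x∙yz≈y∙xz (f x) (f y) _)
∑-↭ f (↭.trans p q)  = trans (∑-↭ f p) (∑-↭ f q)

∑-filter : ∀ {P : X → Set} (P? : Decidable P) xs f →
         ∑ (filter P? xs) f ≡ ∑[ x ∈ xs ] (if does (P? x) then f x else 0ℤ)
∑-filter P? []       f = refl
∑-filter P? (x ∷ xs) f with does (P? x)
... | true  = cong (f x +ℤ_) (∑-filter P? xs f)
... | false = trans (∑-filter P? xs f) (sym (ℤ.+-identityˡ _))

∑-if : ∀ (xs : List X) b (c : X → Bool) (f : X → ℤ) →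
     ∑[ x ∈ xs ] (if b ∧ c x then f x else 0ℤ) ≡ (if b then ∑[ x ∈ xs ] (if c x then f x else 0ℤ) else 0ℤ)
∑-if xs true  c f = refl
∑-if xs false c f = ∑-0 xs

∑-map : ∀ (g : X → Y) xs f → ∑ (map g xs) f ≡ ∑ xs (f ∘ g)
∑-map g []       f = refl
∑-map g (x ∷ xs) f = cong (f (g x) +ℤ_) (∑-map g xs f)

∑-concatMap : ∀ (g : X → List Y) xs f → ∑ (concatMap g xs) f ≡ ∑[ x ∈ xs ] ∑ (g x) f
∑-concatMap g []       f = refl
∑-concatMap g (x ∷ xs) f = trans (∑-++ (g x) _ f) (cong (∑ (g x) f +ℤ_) (∑-concatMap g xs f))

∑-mapMaybe : ∀ (g : X → Maybe Y) xs f → ∑ (mapMaybe g xs) f ≡ ∑[ x ∈ xs ] maybe f 0ℤ (g x)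
∑-mapMaybe g []       f = refl
∑-mapMaybe g (x ∷ xs) f with g x
... | just y  = cong (f y +ℤ_) (∑-mapMaybe g xs f)
... | nothing = trans (∑-mapMaybe g xs f) (sym (ℤ.+-identityˡ _))

-- Sums over arrangements

_∖_ : List ℕ → ℕ → List ℕ
A ∖ j = filter (λ x → ¬? (x ≟ j)) A

∖-head : ∀ {x A} → All (x ≢_) A → (x ∷ A) ∖ x ≡ A
∖-head {x} x∉A = trans (filter-reject (λ y → ¬? (y ≟ x)) (λ x≢x → x≢x refl))
                       (filter-all (λ y → ¬? (y ≟ x)) (All.map (λ x≢y y≡x → x≢y (sym y≡x)) x∉A))

∖-skip : ∀ {x j} A → x ≢ j → (x ∷ A) ∖ j ≡ x ∷ (A ∖ j)
∖-skip {j = j} A x≢j = filter-accept (λ y → ¬? (y ≟ j)) x≢j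

∖-↭ : ∀ {A j} → Unique A → j ∈ A → A ↭ j ∷ (A ∖ j)
∖-↭ {x ∷ A} (x∉A ∷ _)  (here refl) = ↭-reflexive (cong (x ∷_) (sym (∖-head x∉A)))
∖-↭ {x ∷ A} (x∉A ∷ A!) (there j∈A) =
  ↭-trans (↭-prep x (∖-↭ A! j∈A))
          (↭-trans (↭-swap x _ ↭-refl) (↭-reflexive (cong (_ ∷_) (sym (∖-skip A (All.lookup x∉A j∈A))))))

-- For duplicate-free A, the sum of F over the words of length k with distinct letters from A; when
-- length A ≡ k, over the arrangements of A.
∑arr : ℕ → List ℕ → (List ℕ → ℤ) → ℤ
∑arr zero    A F = F []
∑arr (suc k) A F = ∑[ j ∈ A ] ∑arr k (A ∖ j) (λ w → F (j ∷ w))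

∑arr-↭ : ∀ k {A B} F → A ↭ B → ∑arr k A F ≡ ∑arr k B F
∑arr-↭ zero    F p = refl
∑arr-↭ (suc k) {A} {B} F p =
  trans (∑-cong A λ {j} _ → ∑arr-↭ k (λ w → F (j ∷ w)) (filter-↭ (λ x → ¬? (x ≟ j)) p))
        (∑-↭ (λ j → ∑arr k (B ∖ j) (λ w → F (j ∷ w))) p)

∖-map : ∀ {s} → Injective _≡_ _≡_ s → ∀ A j → map s A ∖ s j ≡ map s (A ∖ j)
∖-map s-inj []      j = refl
∖-map {s} s-inj (x ∷ A) j with x ≟ j
... | yes refl = begin
  map s (x ∷ A) ∖ s x  ≡⟨ filter-reject (λ y → ¬? (y ≟ s x)) (λ sx≢sx → sx≢sx refl) ⟩
  map s A ∖ s x        ≡⟨ ∖-map s-inj A x ⟩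
  map s (A ∖ x)        ≡⟨ cong (map s) (filter-reject (λ y → ¬? (y ≟ x)) (λ x≢x → x≢x refl)) ⟨
  map s ((x ∷ A) ∖ x)  ∎
... | no x≢j = begin
  map s (x ∷ A) ∖ s j  ≡⟨ filter-accept (λ y → ¬? (y ≟ s j)) (x≢j ∘ s-inj) ⟩
  s x ∷ map s A ∖ s j  ≡⟨ cong (s x ∷_) (∖-map s-inj A j) ⟩
  map s (x ∷ A ∖ j)    ≡⟨ cong (map s) (filter-accept (λ y → ¬? (y ≟ j)) x≢j) ⟨
  map s ((x ∷ A) ∖ j)  ∎

∑arr-map : ∀ k {s} → Injective _≡_ _≡_ s → ∀ A F → ∑arr k (map s A) F ≡ ∑arr k A (F ∘ map s)
∑arr-map zero    s-inj A F = refl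
∑arr-map (suc k) {s} s-inj A F =
  trans (∑-map s A (λ j → ∑arr k (map s A ∖ j) (λ w → F (j ∷ w)))) (∑-cong A λ {j} _ →
  trans (cong (λ B → ∑arr k B (λ w → F (s j ∷ w))) (∖-map s-inj A j)) (∑arr-map k s-inj (A ∖ j) _))

∑arr-neg : ∀ k A F → ∑arr k A (λ w → - F w) ≡ - ∑arr k A F
∑arr-neg zero    A F = refl
∑arr-neg (suc k) A F = trans (∑-cong A λ {j} _ → ∑arr-neg k (A ∖ j) (λ w → F (j ∷ w)))
                               (∑-neg A (λ j → ∑arr k (A ∖ j) (λ w → F (j ∷ w))))

∑arr-cong : ∀ k {A F G} → Unique A → length A ≡ k → (∀ w → w ↭ A → F w ≡ G w) →
            ∑arr k A F ≡ ∑arr k A G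
∑arr-cong zero    {[]} _ _ eq = eq [] ↭-refl
∑arr-cong (suc k) {A} A! len eq = ∑-cong A λ {j} j∈A →
  ∑arr-cong k (Unique.filter⁺ _ A!) (suc-injective (trans (sym (↭-length (∖-↭ A! j∈A))) len))
    λ w p → eq (j ∷ w) (↭-trans (↭-prep j p) (↭-sym (∖-↭ A! j∈A)))

x≡-x⇒x≡0 : ∀ {x : ℤ} → x ≡ - x → x ≡ 0ℤ
x≡-x⇒x≡0 {pos zero}    _  = refl
x≡-x⇒x≡0 {pos (suc _)} ()
x≡-x⇒x≡0 { -[1+ _ ]} ()

∑arr-sign-reversing : ∀ k {A F s} → Unique A → length A ≡ k → Injective _≡_ _≡_ s → map s A ↭ A →
                      (∀ w → w ↭ A → F (map s w) ≡ - F w) → ∑arr k A F ≡ 0ℤ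
∑arr-sign-reversing k {A} {F} {s} A! len s-inj sA↭A reverses = x≡-x⇒x≡0 (begin
  ∑arr k A F                 ≡⟨ ∑arr-↭ k F (↭-sym sA↭A) ⟩
  ∑arr k (map s A) F         ≡⟨ ∑arr-map k s-inj A F ⟩
  ∑arr k A (F ∘ map s)       ≡⟨ ∑arr-cong k A! len reverses ⟩
  ∑arr k A (λ w → - F w)     ≡⟨ ∑arr-neg k A F ⟩
  - ∑arr k A F               ∎)

fresh : List ℕ → List ℕ → Bool
fresh U []      = true
fresh U (x ∷ w) = not (does (x ∈? U)) ∧ fresh (x ∷ U) w

available : ℕ → List ℕ → List ℕ
available n U = filter (_∉? U) (upTo n)

available-[] : ∀ n → upTo n ≡ available n []
available-[] n = sym (filter-all (_∉? []) (All.universal (λ _ ()) (upTo n)))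

filter-∉-∷ : ∀ j U xs → filter (_∉? (j ∷ U)) xs ≡ filter (_∉? U) xs ∖ j
filter-∉-∷ j U []       = refl
filter-∉-∷ j U (x ∷ xs) = split (x ∈? U) (x ≟ j)
  where
  ih : filter (_∉? (j ∷ U)) xs ≡ filter (_∉? U) xs ∖ j
  ih = filter-∉-∷ j U xs
  split : Dec (x ∈ U) → Dec (x ≡ j) → filter (_∉? (j ∷ U)) (x ∷ xs) ≡ filter (_∉? U) (x ∷ xs) ∖ j
  split (yes x∈U) _ = begin
    filter (_∉? (j ∷ U)) (x ∷ xs)  ≡⟨ filter-reject (_∉? (j ∷ U)) (λ x∉ → x∉ (there x∈U)) ⟩
    filter (_∉? (j ∷ U)) xs        ≡⟨ ih ⟩
    filter (_∉? U) xs ∖ j          ≡⟨ cong (_∖ j) (filter-reject (_∉? U) (λ x∉ → x∉ x∈U)) ⟨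
    filter (_∉? U) (x ∷ xs) ∖ j    ∎
  split (no x∉U) (yes refl) = begin
    filter (_∉? (j ∷ U)) (x ∷ xs)  ≡⟨ filter-reject (_∉? (j ∷ U)) (λ x∉ → x∉ (here refl)) ⟩
    filter (_∉? (j ∷ U)) xs        ≡⟨ ih ⟩
    filter (_∉? U) xs ∖ j          ≡⟨ filter-reject (λ y → ¬? (y ≟ j)) (λ x≢x → x≢x refl) ⟨
    (x ∷ filter (_∉? U) xs) ∖ j    ≡⟨ cong (_∖ j) (filter-accept (_∉? U) x∉U) ⟨
    filter (_∉? U) (x ∷ xs) ∖ j    ∎
  split (no x∉U) (no x≢j) = begin
    filter (_∉? (j ∷ U)) (x ∷ xs)  ≡⟨ filter-accept (_∉? (j ∷ U)) x∉jU ⟩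
    x ∷ filter (_∉? (j ∷ U)) xs    ≡⟨ cong (x ∷_) ih ⟩
    x ∷ filter (_∉? U) xs ∖ j      ≡⟨ filter-accept (λ y → ¬? (y ≟ j)) x≢j ⟨
    (x ∷ filter (_∉? U) xs) ∖ j    ≡⟨ cong (_∖ j) (filter-accept (_∉? U) x∉U) ⟨
    filter (_∉? U) (x ∷ xs) ∖ j    ∎
    where
    x∉jU : x ∉ j ∷ U
    x∉jU (here x≡j)  = x≢j x≡j
    x∉jU (there x∈U) = x∉U x∈U

word : ∀ {n k} → Vec (Fin n) k → List ℕ
word v = map toℕ (toList v)

map-toℕ-allFin : ∀ n → map toℕ (allFin n) ≡ upTo n
map-toℕ-allFin n = trans (map-tabulate id toℕ) (tabulate-toℕ n id)
  where
  tabulate-toℕ : ∀ n (f : ℕ → ℕ) → tabulate {n = n} (f ∘ toℕ) ≡ applyUpTo f n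
  tabulate-toℕ zero    f = refl
  tabulate-toℕ (suc n) f = cong (f 0 ∷_) (tabulate-toℕ n (f ∘ suc))

∑-words : ∀ n k U (F : List ℕ → ℤ) →
          ∑[ v ∈ words n k ] (if fresh U (word v) then F (word v) else 0ℤ) ≡ ∑arr k (available n U) F
∑-words n zero    U F = ℤ.+-identityʳ (F [])
∑-words n (suc k) U F = begin
  ∑ (concatMap (λ i → map (i ∷ᵛ_) (words n k)) (allFin n)) G
    ≡⟨ ∑-concatMap _ (allFin n) G ⟩
  ∑[ i ∈ allFin n ] ∑ (map (i ∷ᵛ_) (words n k)) G
    ≡⟨ ∑-cong (allFin n) (λ {i} _ → first-letter i) ⟩
  ∑[ i ∈ allFin n ] h (toℕ i)
    ≡⟨ ∑-map toℕ (allFin n) h ⟨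
  ∑[ j ∈ map toℕ (allFin n) ] h j
    ≡⟨ cong (λ js → ∑ js h) (map-toℕ-allFin n) ⟩
  ∑[ j ∈ upTo n ] h j
    ≡⟨ ∑-filter (_∉? U) (upTo n) g ⟨
  ∑[ j ∈ available n U ] g j
    ≡⟨ ∑-cong (available n U) (λ {j} _ → cong (λ A → ∑arr k A (λ w → F (j ∷ w))) (filter-∉-∷ j U (upTo n))) ⟩
  ∑arr (suc k) (available n U) F ∎
  where
  G : Vec (Fin n) (suc k) → ℤ
  G v = if fresh U (word v) then F (word v) else 0ℤ
  g : ℕ → ℤ
  g j = ∑arr k (available n (j ∷ U)) (λ w → F (j ∷ w))
  h : ℕ → ℤ
  h j = if not (does (j ∈? U)) then g j else 0ℤ
  first-letter : ∀ i → ∑ (map (i ∷ᵛ_) (words n k)) G ≡ h (toℕ i)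
  first-letter i = trans (∑-map (i ∷ᵛ_) (words n k) G) (trans (∑-if (words n k) _ _ _)
    (cong (λ s → if not (does (toℕ i ∈? U)) then s else 0ℤ) (∑-words n k (toℕ i ∷ U) (λ w → F (toℕ i ∷ w)))))

≟-toℕ : ∀ {n} (x y : Fin n) → ⌊ x Fin.≟ y ⌋ ≡ does (toℕ y ≟ toℕ x)
≟-toℕ x y with x Fin.≟ y
... | yes refl = sym (dec-true (toℕ x ≟ toℕ x) refl)
... | no x≢y   = sym (dec-false (toℕ y ≟ toℕ x) (λ y≡x → x≢y (sym (Fin.toℕ-injective y≡x))))

avoids : ∀ {n} → List ℕ → List (Fin n) → Bool
avoids U = all (λ y → not (does (toℕ y ∈? U)))

avoids-∷ : ∀ {n} (x : Fin n) U l → avoids (toℕ x ∷ U) l ≡ avoids U l ∧ not (any (λ y → ⌊ x Fin.≟ y ⌋) l)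
avoids-∷ x U []      = refl
avoids-∷ x U (y ∷ l) rewrite avoids-∷ x U l | ≟-toℕ x y with does (toℕ y ≟ toℕ x)
... | true  = sym (∧-zeroʳ _)
... | false = sym (∧-assoc (not (does (toℕ y ∈? U))) (avoids U l) _)

fresh-distinct : ∀ {n} U (l : List (Fin n)) → fresh U (map toℕ l) ≡ avoids U l ∧ distinct l
fresh-distinct U []      = refl
fresh-distinct U (x ∷ l) = begin
  notx ∧ fresh (toℕ x ∷ U) (map toℕ l)      ≡⟨ cong (notx ∧_) (fresh-distinct (toℕ x ∷ U) l) ⟩
  notx ∧ (avoids (toℕ x ∷ U) l ∧ distinct l) ≡⟨ cong (λ b → notx ∧ (b ∧ distinct l)) (avoids-∷ x U l) ⟩
  notx ∧ ((av ∧ nx) ∧ distinct l)           ≡⟨ cong (notx ∧_) (∧-assoc av nx (distinct l)) ⟩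
  notx ∧ (av ∧ (nx ∧ distinct l))           ≡⟨ ∧-assoc notx av _ ⟨
  (notx ∧ av) ∧ (nx ∧ distinct l)           ∎
  where
  notx = not (does (toℕ x ∈? U))
  av = avoids U l
  nx = not (any (λ y → ⌊ x Fin.≟ y ⌋) l)

distinct≡fresh : ∀ {n} (l : List (Fin n)) → distinct l ≡ fresh [] (map toℕ l)
distinct≡fresh l = sym (trans (fresh-distinct [] l) (cong (_∧ distinct l) (avoids-[] l)))
  where
  avoids-[] : ∀ l → avoids [] l ≡ true
  avoids-[] []      = refl
  avoids-[] (_ ∷ l) = avoids-[] l

∑-allPerms : ∀ n (f : List ℕ → ℤ) →
             ∑[ σ ∈ allPerms n ] f (oneLine σ) ≡ ∑[ v ∈ words n n ] (if isPerm v then f (word v) else 0ℤ)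
∑-allPerms n f =
  trans (∑-mapMaybe toPerm (words n n) (f ∘ oneLine)) (∑-cong (words n n) λ {v} _ → toPerm-term v)
  where
  if-true : ∀ {b} {x y : ℤ} → T b → (if b then x else y) ≡ x
  if-true {true} _ = refl
  if-false : ∀ {b} {x y : ℤ} → ¬ T b → (if b then x else y) ≡ y
  if-false {true}  ¬t = contradiction _ ¬t
  if-false {false} _  = refl
  toPerm-term : ∀ v → maybe (f ∘ oneLine) 0ℤ (toPerm v) ≡ (if isPerm v then f (word v) else 0ℤ)
  toPerm-term v with T? (isPerm v)
  ... | yes isPerm-v = sym (if-true isPerm-v)
  ... | no ¬isPerm-v = sym (if-false ¬isPerm-v)

genPoly-at-1 : ∀ {X : Set} (xs : List X) stat → genPoly xs stat (pos 1) ≡ pos (length xs)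
genPoly-at-1 []       stat = refl
genPoly-at-1 (x ∷ xs) stat = cong₂ _+ℤ_ (ℤ.^-zeroˡ (stat x)) (genPoly-at-1 xs stat)

-- Signs and exchanges of two values

sign : ℕ → ℤ
sign m = -1ℤ ^ℤ m

sign-suc : ∀ m → sign (suc m) ≡ - sign m
sign-suc m = ℤ.-1*i≡-i (sign m)

sign-flip : ∀ {m n} → suc m ≡ n ⊎ m ≡ suc n → sign m ≡ - sign n
sign-flip {m} (inj₁ refl) = sym (trans (cong -_ (sign-suc m)) (ℤ.neg-involutive (sign m)))
sign-flip {n = n} (inj₂ refl) = sign-suc n

sign-flip-+ : ∀ c {m n} → sign m ≡ - sign n → sign (c + m) ≡ - sign (c + n)
sign-flip-+ c {m} {n} flip = begin
  sign (c + m)             ≡⟨ ℤ.^-distribˡ-+-* -1ℤ c m ⟩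
  sign c *ℤ sign m         ≡⟨ cong (sign c *ℤ_) flip ⟩
  sign c *ℤ - sign n       ≡⟨ ℤ.neg-distribʳ-* (sign c) (sign n) ⟨
  - (sign c *ℤ sign n)     ≡⟨ cong -_ (ℤ.^-distribˡ-+-* -1ℤ c n) ⟨
  - sign (c + n)           ∎

count : ℕ → List ℕ → ℕ
count c xs = length (filter (_≟ c) xs)

count-∷≡ : ∀ {c} xs → count c (c ∷ xs) ≡ suc (count c xs)
count-∷≡ {c} xs = cong length (filter-accept (_≟ c) {xs = xs} refl)

count-∷≢ : ∀ {c y} xs → y ≢ c → count c (y ∷ xs) ≡ count c xs
count-∷≢ {c} xs y≢c = cong length (filter-reject (_≟ c) {xs = xs} y≢c)

count-∷ : ∀ c y {xs ys} → count c xs ≡ count c ys → count c (y ∷ xs) ≡ count c (y ∷ ys)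
count-∷ c y eq with does (y ≟ c)
... | true  = cong suc eq
... | false = eq

count-absent : ∀ {c xs} → All (c <_) xs → count c xs ≡ 0
count-absent {c} c<xs = cong length (filter-none (_≟ c) (All.map >⇒≢ c<xs))

count-↭ : ∀ c {xs ys} → xs ↭ ys → count c xs ≡ count c ys
count-↭ c p = ↭-length (filter-↭ (_≟ c) p)

nonLR-All : ∀ {P : ℕ → Set} bs {xs} → All P xs → All P (nonLR bs xs)
nonLR-All []           _          = []
nonLR-All (_ ∷ _)      []         = []
nonLR-All (true ∷ bs)  (_ ∷ pxs)  = nonLR-All bs pxs
nonLR-All (false ∷ bs) (px ∷ pxs) = px ∷ nonLR-All bs pxs

nonMaximaAfter-below : ∀ {M} w → All (M <_) w → nonMaximaAfter M w ≡ nonMaxima w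
nonMaximaAfter-below []      _          = refl
nonMaximaAfter-below (y ∷ w) (M<y ∷ _) = nonMaximaAfter-max w M<y

count-nonMaximaAfter : ∀ {c M} w → c ≤ M → count c (nonMaximaAfter M w) ≡ count c w
count-nonMaximaAfter []      _ = refl
count-nonMaximaAfter {c} {M} (y ∷ w) c≤M with <-≤-connex M y
... | inj₁ M<y = begin
  count c (nonMaximaAfter M (y ∷ w))  ≡⟨ cong (count c) (nonMaximaAfter-max w M<y) ⟩
  count c (nonMaximaAfter y w)        ≡⟨ count-nonMaximaAfter w (≤-trans c≤M (<⇒≤ M<y)) ⟩
  count c w                           ≡⟨ count-∷≢ w (>⇒≢ (≤-<-trans c≤M M<y)) ⟨
  count c (y ∷ w)                     ∎
... | inj₂ y≤M = trans (cong (count c) (nonMaximaAfter-nonmax w y≤M)) (count-∷ c y (count-nonMaximaAfter w c≤M))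

transpose : ℕ → ℕ → ℕ → ℕ
transpose a b x = if does (x ≟ a) then b else if does (x ≟ b) then a else x

transpose-a : ∀ a b → transpose a b a ≡ b
transpose-a a b rewrite dec-true (a ≟ a) refl = refl

transpose-b : ∀ {a b} → a ≢ b → transpose a b b ≡ a
transpose-b {a} {b} a≢b rewrite dec-false (b ≟ a) (a≢b ∘ sym) | dec-true (b ≟ b) refl = refl

transpose-other : ∀ {a b x} → x ≢ a → x ≢ b → transpose a b x ≡ x
transpose-other {a} {b} {x} x≢a x≢b rewrite dec-false (x ≟ a) x≢a | dec-false (x ≟ b) x≢b = refl

transpose-above : ∀ {a b y} → a < b → b < y → transpose a b y ≡ y
transpose-above a<b b<y = transpose-other (>⇒≢ (<-trans a<b b<y)) (>⇒≢ b<y)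

transpose-involutive : ∀ {a b} → a ≢ b → ∀ x → transpose a b (transpose a b x) ≡ x
transpose-involutive {a} {b} a≢b x with x ≟ a | x ≟ b
... | yes refl | _        = trans (cong (transpose a b) (transpose-a a b)) (transpose-b a≢b)
... | no _     | yes refl = trans (cong (transpose a b) (transpose-b a≢b)) (transpose-a a b)
... | no x≢a   | no x≢b   = trans (cong (transpose a b) (transpose-other x≢a x≢b)) (transpose-other x≢a x≢b)

transpose-injective : ∀ {a b} → a ≢ b → Injective _≡_ _≡_ (transpose a b)
transpose-injective a≢b {x} {y} sx≡sy =
  trans (sym (transpose-involutive a≢b x)) (trans (cong (transpose _ _) sx≡sy) (transpose-involutive a≢b y))

Outside : ℕ → ℕ → ℕ → Set
Outside a b y = y ≤ a ⊎ b ≤ y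

data Position (a b : ℕ) : ℕ → Set where
  at-a  : Position a b a
  at-b  : Position a b b
  other : ∀ {y} → y < a ⊎ b < y → Position a b y

position : ∀ {a b y} → Outside a b y → Position a b y
position (inj₁ y≤a) with m≤n⇒m<n∨m≡n y≤a
... | inj₁ y<a  = other (inj₁ y<a)
... | inj₂ refl = at-a
position (inj₂ b≤y) with m≤n⇒m<n∨m≡n b≤y
... | inj₁ b<y  = other (inj₂ b<y)
... | inj₂ refl = at-b

module _ {a b : ℕ} (a<b : a < b) where

  private
    s = transpose a b

    s-a : ∀ {xs} → map s (a ∷ xs) ≡ b ∷ map s xs
    s-a {xs} = cong (_∷ map s xs) (transpose-a a b)

    s-b : ∀ {xs} → map s (b ∷ xs) ≡ a ∷ map s xs
    s-b {xs} = cong (_∷ map s xs) (transpose-b (<⇒≢ a<b))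

    other≢a : ∀ {y} → y < a ⊎ b < y → y ≢ a
    other≢a (inj₁ y<a) = <⇒≢ y<a
    other≢a (inj₂ b<y) = >⇒≢ (<-trans a<b b<y)

    other≢b : ∀ {y} → y < a ⊎ b < y → y ≢ b
    other≢b (inj₁ y<a) = <⇒≢ (<-trans y<a a<b)
    other≢b (inj₂ b<y) = >⇒≢ b<y

    s-other : ∀ {y xs} → y < a ⊎ b < y → map s (y ∷ xs) ≡ y ∷ map s xs
    s-other {xs = xs} y∉[a,b] = cong (_∷ map s xs) (transpose-other (other≢a y∉[a,b]) (other≢b y∉[a,b]))

  count<-transpose-outside : ∀ {x} → x < a ⊎ b < x → ∀ l → All (Outside a b) l →
                             count< x (map s l) ≡ count< x l
  count<-transpose-outside side [] [] = refl
  count<-transpose-outside {x} side (y ∷ l) (o ∷ os) with position o | side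
  ... | other y∉[a,b] | _ =
    trans (cong (count< x) (s-other y∉[a,b])) (count<-∷ x y (count<-transpose-outside side l os))
  ... | at-a | inj₁ x<a = begin
    count< x (map s (a ∷ l))  ≡⟨ cong (count< x) s-a ⟩
    count< x (b ∷ map s l)    ≡⟨ count<-∷≥ _ (<⇒≤ (<-trans x<a a<b)) ⟩
    count< x (map s l)        ≡⟨ count<-transpose-outside side l os ⟩
    count< x l                ≡⟨ count<-∷≥ l (<⇒≤ x<a) ⟨
    count< x (a ∷ l)          ∎
  ... | at-a | inj₂ b<x = begin
    count< x (map s (a ∷ l))  ≡⟨ cong (count< x) s-a ⟩
    count< x (b ∷ map s l)    ≡⟨ count<-∷< _ b<x ⟩
    suc (count< x (map s l))  ≡⟨ cong suc (count<-transpose-outside side l os) ⟩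
    suc (count< x l)          ≡⟨ count<-∷< l (<-trans a<b b<x) ⟨
    count< x (a ∷ l)          ∎
  ... | at-b | inj₁ x<a = begin
    count< x (map s (b ∷ l))  ≡⟨ cong (count< x) s-b ⟩
    count< x (a ∷ map s l)    ≡⟨ count<-∷≥ _ (<⇒≤ x<a) ⟩
    count< x (map s l)        ≡⟨ count<-transpose-outside side l os ⟩
    count< x l                ≡⟨ count<-∷≥ l (<⇒≤ (<-trans x<a a<b)) ⟨
    count< x (b ∷ l)          ∎
  ... | at-b | inj₂ b<x = begin
    count< x (map s (b ∷ l))  ≡⟨ cong (count< x) s-b ⟩
    count< x (a ∷ map s l)    ≡⟨ count<-∷< _ (<-trans a<b b<x) ⟩
    suc (count< x (map s l))  ≡⟨ cong suc (count<-transpose-outside side l os) ⟩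
    suc (count< x l)          ≡⟨ count<-∷< l b<x ⟨
    count< x (b ∷ l)          ∎

  count<-transpose-b : ∀ l → All (Outside a b) l → count< b (map s l) ≡ count< a l + count b l
  count<-transpose-b [] [] = refl
  count<-transpose-b (y ∷ l) (o ∷ os) with position o
  ... | other (inj₁ y<a) = begin
    count< b (map s (y ∷ l))            ≡⟨ cong (count< b) (s-other (inj₁ y<a)) ⟩
    count< b (y ∷ map s l)              ≡⟨ count<-∷< _ (<-trans y<a a<b) ⟩
    suc (count< b (map s l))            ≡⟨ cong suc (count<-transpose-b l os) ⟩
    suc (count< a l + count b l)        ≡⟨ cong₂ _+_ (count<-∷< l y<a) (count-∷≢ l (other≢b (inj₁ y<a))) ⟨
    count< a (y ∷ l) + count b (y ∷ l)  ∎
  ... | other (inj₂ b<y) = begin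
    count< b (map s (y ∷ l))            ≡⟨ cong (count< b) (s-other (inj₂ b<y)) ⟩
    count< b (y ∷ map s l)              ≡⟨ count<-∷≥ _ (<⇒≤ b<y) ⟩
    count< b (map s l)                  ≡⟨ count<-transpose-b l os ⟩
    count< a l + count b l
      ≡⟨ cong₂ _+_ (count<-∷≥ l (<⇒≤ (<-trans a<b b<y))) (count-∷≢ l (other≢b (inj₂ b<y))) ⟨
    count< a (y ∷ l) + count b (y ∷ l)  ∎
  ... | at-a = begin
    count< b (map s (a ∷ l))            ≡⟨ cong (count< b) s-a ⟩
    count< b (b ∷ map s l)              ≡⟨ count<-∷≥ {b} (map s l) ≤-refl ⟩
    count< b (map s l)                  ≡⟨ count<-transpose-b l os ⟩
    count< a l + count b l              ≡⟨ cong₂ _+_ (count<-∷≥ l ≤-refl) (count-∷≢ l (<⇒≢ a<b)) ⟨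
    count< a (a ∷ l) + count b (a ∷ l)  ∎
  ... | at-b = begin
    count< b (map s (b ∷ l))            ≡⟨ cong (count< b) s-b ⟩
    count< b (a ∷ map s l)              ≡⟨ count<-∷< _ a<b ⟩
    suc (count< b (map s l))            ≡⟨ cong suc (count<-transpose-b l os) ⟩
    suc (count< a l + count b l)        ≡⟨ +-suc (count< a l) (count b l) ⟨
    count< a l + suc (count b l)        ≡⟨ cong₂ _+_ (count<-∷≥ l (<⇒≤ a<b)) (count-∷≡ l) ⟨
    count< a (b ∷ l) + count b (b ∷ l)  ∎

  count<-transpose-a : ∀ l → All (Outside a b) l → count< a (map s l) + count a l ≡ count< b l
  count<-transpose-a [] [] = refl
  count<-transpose-a (y ∷ l) (o ∷ os) with position o
  ... | other (inj₁ y<a) = begin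
    count< a (map s (y ∷ l)) + count a (y ∷ l)
      ≡⟨ cong₂ _+_ (cong (count< a) (s-other (inj₁ y<a))) (count-∷≢ l (<⇒≢ y<a)) ⟩
    count< a (y ∷ map s l) + count a l
      ≡⟨ cong (_+ count a l) (count<-∷< _ y<a) ⟩
    suc (count< a (map s l) + count a l)
      ≡⟨ cong suc (count<-transpose-a l os) ⟩
    suc (count< b l)
      ≡⟨ count<-∷< l (<-trans y<a a<b) ⟨
    count< b (y ∷ l) ∎
  ... | other (inj₂ b<y) = begin
    count< a (map s (y ∷ l)) + count a (y ∷ l)
      ≡⟨ cong₂ _+_ (cong (count< a) (s-other (inj₂ b<y))) (count-∷≢ l (other≢a (inj₂ b<y))) ⟩
    count< a (y ∷ map s l) + count a l
      ≡⟨ cong (_+ count a l) (count<-∷≥ _ (<⇒≤ (<-trans a<b b<y))) ⟩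
    count< a (map s l) + count a l
      ≡⟨ count<-transpose-a l os ⟩
    count< b l
      ≡⟨ count<-∷≥ l (<⇒≤ b<y) ⟨
    count< b (y ∷ l) ∎
  ... | at-a = begin
    count< a (map s (a ∷ l)) + count a (a ∷ l)
      ≡⟨ cong₂ _+_ (cong (count< a) s-a) (count-∷≡ l) ⟩
    count< a (b ∷ map s l) + suc (count a l)
      ≡⟨ cong (_+ suc (count a l)) (count<-∷≥ _ (<⇒≤ a<b)) ⟩
    count< a (map s l) + suc (count a l)
      ≡⟨ +-suc (count< a (map s l)) (count a l) ⟩
    suc (count< a (map s l) + count a l)
      ≡⟨ cong suc (count<-transpose-a l os) ⟩
    suc (count< b l)
      ≡⟨ count<-∷< l a<b ⟨
    count< b (a ∷ l) ∎
  ... | at-b = begin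
    count< a (map s (b ∷ l)) + count a (b ∷ l)
      ≡⟨ cong₂ _+_ (cong (count< a) s-b) (count-∷≢ l (>⇒≢ a<b)) ⟩
    count< a (a ∷ map s l) + count a l
      ≡⟨ cong (_+ count a l) (count<-∷≥ {a} (map s l) ≤-refl) ⟩
    count< a (map s l) + count a l
      ≡⟨ count<-transpose-a l os ⟩
    count< b l
      ≡⟨ count<-∷≥ l ≤-refl ⟨
    count< b (b ∷ l) ∎

  private
    inv-transpose-other : ∀ {y} l → All (Outside a b) l → y < a ⊎ b < y →
                          inv (map s (y ∷ l)) ≡ count< y l + inv (map s l)
    inv-transpose-other {y} l os y∉[a,b] = begin
      inv (map s (y ∷ l))                  ≡⟨ cong inv (s-other {xs = l} y∉[a,b]) ⟩
      count< y (map s l) + inv (map s l)   ≡⟨ cong (_+ inv (map s l)) (count<-transpose-outside y∉[a,b] l os) ⟩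
      count< y l + inv (map s l)           ∎

  inv-transpose-absent : ∀ l → All (Outside a b) l → count a l ≡ 0 ⊎ count b l ≡ 0 → inv (map s l) ≡ inv l
  inv-transpose-absent [] [] _ = refl
  inv-transpose-absent (y ∷ l) (o ∷ os) absent with position o | absent
  ... | other y∉[a,b] | _ =
    trans (inv-transpose-other l os y∉[a,b]) (cong (count< y l +_) (inv-transpose-absent l os absent′))
    where
    absent′ : count a l ≡ 0 ⊎ count b l ≡ 0
    absent′ = Sum.map (trans (sym (count-∷≢ l (other≢a y∉[a,b]))))
                      (trans (sym (count-∷≢ l (other≢b y∉[a,b])))) absent
  ... | at-a | inj₁ no-a = contradiction (trans (sym (count-∷≡ {a} l)) no-a) λ ()
  ... | at-b | inj₂ no-b = contradiction (trans (sym (count-∷≡ {b} l)) no-b) λ ()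
  ... | at-a | inj₂ no-b = begin
    inv (map s (a ∷ l))                     ≡⟨ cong inv (s-a {l}) ⟩
    count< b (map s l) + inv (map s l)
      ≡⟨ cong₂ _+_ (count<-transpose-b l os) (inv-transpose-absent l os (inj₂ no-b′)) ⟩
    count< a l + count b l + inv l          ≡⟨ cong (λ n → count< a l + n + inv l) no-b′ ⟩
    count< a l + 0 + inv l                  ≡⟨ cong (_+ inv l) (+-identityʳ (count< a l)) ⟩
    inv (a ∷ l)                             ∎
    where
    no-b′ : count b l ≡ 0
    no-b′ = trans (sym (count-∷≢ l (<⇒≢ a<b))) no-b
  ... | at-b | inj₁ no-a = begin
    inv (map s (b ∷ l))                     ≡⟨ cong inv (s-b {l}) ⟩
    count< a (map s l) + inv (map s l)
      ≡⟨ cong (count< a (map s l) +_) (inv-transpose-absent l os (inj₁ no-a′)) ⟩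
    count< a (map s l) + inv l              ≡⟨ cong (_+ inv l) (+-identityʳ _) ⟨
    count< a (map s l) + 0 + inv l          ≡⟨ cong (λ n → count< a (map s l) + n + inv l) no-a′ ⟨
    count< a (map s l) + count a l + inv l  ≡⟨ cong (_+ inv l) (count<-transpose-a l os) ⟩
    inv (b ∷ l)                             ∎
    where
    no-a′ : count a l ≡ 0
    no-a′ = trans (sym (count-∷≢ l (>⇒≢ a<b))) no-a

  inv-transpose-once : ∀ l → All (Outside a b) l → count a l ≡ 1 → count b l ≡ 1 →
                       sign (inv (map s l)) ≡ - sign (inv l)
  inv-transpose-once (y ∷ l) (o ∷ os) once-a once-b with position o
  ... | other y∉[a,b] =
    trans (cong sign (inv-transpose-other l os y∉[a,b]))
          (sign-flip-+ (count< y l)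
            (inv-transpose-once l os (tail once-a (other≢a y∉[a,b])) (tail once-b (other≢b y∉[a,b]))))
    where
    tail : ∀ {c} → count c (y ∷ l) ≡ 1 → y ≢ c → count c l ≡ 1
    tail once y≢c = trans (sym (count-∷≢ l y≢c)) once
  ... | at-a = sign-flip (inj₂ (begin
    inv (map s (a ∷ l))                     ≡⟨ cong inv (s-a {l}) ⟩
    count< b (map s l) + inv (map s l)
      ≡⟨ cong₂ _+_ (count<-transpose-b l os) (inv-transpose-absent l os (inj₁ no-a)) ⟩
    count< a l + count b l + inv l          ≡⟨ cong (λ n → count< a l + n + inv l) one-b ⟩
    count< a l + 1 + inv l                  ≡⟨ cong (_+ inv l) (+-comm (count< a l) 1) ⟩
    suc (inv (a ∷ l))                       ∎))
    where
    no-a : count a l ≡ 0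
    no-a = suc-injective (trans (sym (count-∷≡ {a} l)) once-a)
    one-b : count b l ≡ 1
    one-b = trans (sym (count-∷≢ l (<⇒≢ a<b))) once-b
  ... | at-b = sign-flip (inj₁ (begin
    suc (inv (map s (b ∷ l)))               ≡⟨ cong (suc ∘ inv) (s-b {l}) ⟩
    suc (count< a (map s l) + inv (map s l))
      ≡⟨ cong (λ n → suc (count< a (map s l) + n)) (inv-transpose-absent l os (inj₂ no-b)) ⟩
    suc (count< a (map s l) + inv l)        ≡⟨ cong (_+ inv l) (+-comm (count< a (map s l)) 1) ⟨
    count< a (map s l) + 1 + inv l          ≡⟨ cong (λ n → count< a (map s l) + n + inv l) one-a ⟨
    count< a (map s l) + count a l + inv l  ≡⟨ cong (_+ inv l) (count<-transpose-a l os) ⟩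
    inv (b ∷ l)                             ∎))
    where
    no-b : count b l ≡ 0
    no-b = suc-injective (trans (sym (count-∷≡ {b} l)) once-b)
    one-a : count a l ≡ 1
    one-a = trans (sym (count-∷≢ l (>⇒≢ a<b))) once-a

  transpose-≤ : ∀ {M y} → b ≤ M → y ≤ M → s y ≤ M
  transpose-≤ {M} {y} b≤M y≤M with y ≟ a | y ≟ b
  ... | yes refl | _        = subst (_≤ M) (sym (transpose-a a b)) b≤M
  ... | no _     | yes refl = subst (_≤ M) (sym (transpose-b (<⇒≢ a<b))) (≤-trans (<⇒≤ a<b) b≤M)
  ... | no y≢a   | no y≢b   = subst (_≤ M) (sym (transpose-other y≢a y≢b)) y≤M

  nonMaximaAfter-transpose : ∀ {M} → b ≤ M → ∀ w → nonMaximaAfter M (map s w) ≡ map s (nonMaximaAfter M w)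
  nonMaximaAfter-transpose b≤M [] = refl
  nonMaximaAfter-transpose {M} b≤M (y ∷ w) with <-≤-connex M y
  ... | inj₁ M<y = begin
    nonMaximaAfter M (map s (y ∷ w))  ≡⟨ cong (nonMaximaAfter M) (s-other {xs = w} (inj₂ (≤-<-trans b≤M M<y))) ⟩
    nonMaximaAfter M (y ∷ map s w)    ≡⟨ nonMaximaAfter-max (map s w) M<y ⟩
    nonMaximaAfter y (map s w)        ≡⟨ nonMaximaAfter-transpose (≤-trans b≤M (<⇒≤ M<y)) w ⟩
    map s (nonMaximaAfter y w)        ≡⟨ cong (map s) (nonMaximaAfter-max w M<y) ⟨
    map s (nonMaximaAfter M (y ∷ w))  ∎
  ... | inj₂ y≤M = begin
    nonMaximaAfter M (s y ∷ map s w)  ≡⟨ nonMaximaAfter-nonmax (map s w) (transpose-≤ b≤M y≤M) ⟩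
    s y ∷ nonMaximaAfter M (map s w)  ≡⟨ cong (s y ∷_) (nonMaximaAfter-transpose b≤M w) ⟩
    s y ∷ map s (nonMaximaAfter M w)  ≡⟨ cong (map s) (nonMaximaAfter-nonmax w y≤M) ⟨
    map s (nonMaximaAfter M (y ∷ w))  ∎

  private
    inv-transpose-above-b : ∀ l → All (b ≤_) l → inv (map s l) ≡ inv l
    inv-transpose-above-b l b≤l =
      inv-transpose-absent l (All.map inj₂ b≤l) (inj₁ (count-absent (All.map (<-≤-trans a<b) b≤l)))

  inv-nonMaximaAfter-transpose : ∀ w → All (b ≤_) w → inv (nonMaximaAfter b (map s w)) ≡ inv (nonMaxima w)
  inv-nonMaximaAfter-transpose []      _           = refl
  inv-nonMaximaAfter-transpose (y ∷ r) (b≤y ∷ b≤r) with m≤n⇒m<n∨m≡n b≤y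
  ... | inj₂ refl = begin
    inv (nonMaximaAfter b (map s (b ∷ r)))   ≡⟨ cong (inv ∘ nonMaximaAfter b) (s-b {r}) ⟩
    inv (nonMaximaAfter b (a ∷ map s r))     ≡⟨ cong inv (nonMaximaAfter-nonmax (map s r) (<⇒≤ a<b)) ⟩
    inv (a ∷ nonMaximaAfter b (map s r))     ≡⟨ cong (inv ∘ (a ∷_)) (nonMaximaAfter-transpose ≤-refl r) ⟩
    count< a (map s L) + inv (map s L)       ≡⟨ cong₂ _+_ below-a (inv-transpose-above-b L b≤L) ⟩
    inv L                                    ∎
    where
    L = nonMaximaAfter b r
    b≤L : All (b ≤_) L
    b≤L = nonLR-All (lrMask b r) b≤r
    a<L : All (a <_) L
    a<L = All.map (<-≤-trans a<b) b≤L
    below-a : count< a (map s L) ≡ 0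
    below-a = begin
      count< a (map s L)              ≡⟨ +-identityʳ _ ⟨
      count< a (map s L) + 0          ≡⟨ cong (count< a (map s L) +_) (count-absent a<L) ⟨
      count< a (map s L) + count a L  ≡⟨ count<-transpose-a L (All.map inj₂ b≤L) ⟩
      count< b L                      ≡⟨ count<-none b≤L ⟩
      0                               ∎
  ... | inj₁ b<y = begin
    inv (nonMaximaAfter b (map s (y ∷ r)))   ≡⟨ cong (inv ∘ nonMaximaAfter b) (s-other {xs = r} (inj₂ b<y)) ⟩
    inv (nonMaximaAfter b (y ∷ map s r))     ≡⟨ cong inv (nonMaximaAfter-max (map s r) b<y) ⟩
    inv (nonMaximaAfter y (map s r))         ≡⟨ cong inv (nonMaximaAfter-transpose (<⇒≤ b<y) r) ⟩
    inv (map s (nonMaximaAfter y r))         ≡⟨ inv-transpose-above-b _ (nonLR-All (lrMask y r) b≤r) ⟩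
    inv (nonMaximaAfter y r)                 ∎

  sign-nonMaximaAfter-transpose : ∀ {j} → b < j → ∀ w → All (Outside a b) w → count a w ≡ 1 → count b w ≡ 1 →
                                  sign (inv (nonMaximaAfter j (map s w))) ≡ - sign (inv (nonMaximaAfter j w))
  sign-nonMaximaAfter-transpose {j} b<j w os once-a once-b = begin
    sign (inv (nonMaximaAfter j (map s w)))  ≡⟨ cong (sign ∘ inv) (nonMaximaAfter-transpose (<⇒≤ b<j) w) ⟩
    sign (inv (map s (nonMaximaAfter j w)))  ≡⟨ inv-transpose-once _ (nonLR-All (lrMask j w) os)
                                                  (trans (count-nonMaximaAfter w (<⇒≤ (<-trans a<b b<j))) once-a)
                                                  (trans (count-nonMaximaAfter w (<⇒≤ b<j)) once-b) ⟩
    - sign (inv (nonMaximaAfter j w))        ∎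

-- The signed sum

strict⇒unique : ∀ {A} → AllPairs _<_ A → Unique A
strict⇒unique = AllPairs.map <⇒≢

∑arr-after-min : ∀ {a A} → All (a <_) A → Unique A →
  ∑arr (length A) A (λ w → sign (inv (nonMaximaAfter a w))) ≡ ∑arr (length A) A (λ w → sign (inv (nonMaxima w)))
∑arr-after-min a<A A! = ∑arr-cong _ A! refl λ w w↭A →
  cong (sign ∘ inv) (nonMaximaAfter-below w (All-resp-↭ (↭-sym w↭A) a<A))

∑arr-after-second-min : ∀ {a b R} → a < b → All (b <_) R → Unique (b ∷ R) →
  ∑arr (length (b ∷ R)) (a ∷ R) (λ w → sign (inv (nonMaximaAfter b w)))
    ≡ ∑arr (length (b ∷ R)) (b ∷ R) (λ w → sign (inv (nonMaxima w)))
∑arr-after-second-min {a} {b} {R} a<b b<R bR! = begin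
  ∑arr k (a ∷ R) G             ≡⟨ cong (λ B → ∑arr k B G) sbR ⟨
  ∑arr k (map s (b ∷ R)) G     ≡⟨ ∑arr-map k (transpose-injective (<⇒≢ a<b)) (b ∷ R) G ⟩
  ∑arr k (b ∷ R) (G ∘ map s)   ≡⟨ ∑arr-cong k bR! refl relabel ⟩
  ∑arr k (b ∷ R) (λ w → sign (inv (nonMaxima w))) ∎
  where
  k = length (b ∷ R)
  s = transpose a b
  G : List ℕ → ℤ
  G w = sign (inv (nonMaximaAfter b w))
  sbR : map s (b ∷ R) ≡ a ∷ R
  sbR = cong₂ _∷_ (transpose-b (<⇒≢ a<b)) (map-id-local (All.map (transpose-above a<b) b<R))
  relabel : ∀ w → w ↭ b ∷ R → G (map s w) ≡ sign (inv (nonMaxima w))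
  relabel w w↭bR =
    cong sign (inv-nonMaximaAfter-transpose a<b w (All-resp-↭ (↭-sym w↭bR) (≤-refl ∷ All.map <⇒≤ b<R)))

∑arr-after-larger : ∀ {a b j C k} → a < b → b < j → All (b <_) C → Unique C → length (a ∷ b ∷ C) ≡ k →
  ∑arr k (a ∷ b ∷ C) (λ w → sign (inv (nonMaximaAfter j w))) ≡ 0ℤ
∑arr-after-larger {a} {b} {j} {C} {k} a<b b<j b<C C! len =
  ∑arr-sign-reversing k B! len (transpose-injective (<⇒≢ a<b)) sB↭B λ w w↭B →
    sign-nonMaximaAfter-transpose a<b b<j w (All-resp-↭ (↭-sym w↭B) outside)
      (trans (count-↭ a w↭B) once-a) (trans (count-↭ b w↭B) once-b)
  where
  a<C : All (a <_) C
  a<C = All.map (<-trans a<b) b<C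
  B! : Unique (a ∷ b ∷ C)
  B! = (<⇒≢ a<b ∷ All.map <⇒≢ a<C) ∷ All.map <⇒≢ b<C ∷ C!
  sB↭B : map (transpose a b) (a ∷ b ∷ C) ↭ a ∷ b ∷ C
  sB↭B rewrite transpose-a a b | transpose-b (<⇒≢ a<b) | map-id-local (All.map (transpose-above a<b) b<C) =
    ↭-swap b a ↭-refl
  outside : All (Outside a b) (a ∷ b ∷ C)
  outside = inj₁ ≤-refl ∷ inj₂ ≤-refl ∷ All.map (inj₂ ∘ <⇒≤) b<C
  once-a : count a (a ∷ b ∷ C) ≡ 1
  once-a = trans (count-∷≡ (b ∷ C)) (cong suc (count-absent (a<b ∷ a<C)))
  once-b : count b (a ∷ b ∷ C) ≡ 1
  once-b = trans (count-∷≢ (b ∷ C) (<⇒≢ a<b)) (trans (count-∷≡ C) (cong suc (count-absent b<C)))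

signedSum : List ℕ → ℤ
signedSum A = ∑arr (length A) A (λ w → sign (inv (nonMaxima w)))

signedSum-doubles : ∀ {a₀ a₁ R} → AllPairs _<_ (a₀ ∷ a₁ ∷ R) →
                    signedSum (a₀ ∷ a₁ ∷ R) ≡ signedSum (a₁ ∷ R) +ℤ signedSum (a₁ ∷ R)
signedSum-doubles {a₀} {a₁} {R} ((a₀<a₁ ∷ a₀<R) ∷ a₁<R ∷ R↗) = begin
  term a₀ +ℤ (term a₁ +ℤ (∑[ j ∈ R ] term j))
    ≡⟨ cong₂ _+ℤ_ smallest (cong₂ _+ℤ_ second-smallest (∑-cong R larger)) ⟩
  S +ℤ (S +ℤ (∑[ j ∈ R ] 0ℤ))                  ≡⟨ cong (λ z → S +ℤ (S +ℤ z)) (∑-0 R) ⟩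
  S +ℤ (S +ℤ 0ℤ)                               ≡⟨ cong (S +ℤ_) (ℤ.+-identityʳ S) ⟩
  S +ℤ S                                       ∎
  where
  S = signedSum (a₁ ∷ R)
  term-on : ℕ → List ℕ → ℤ
  term-on j B = ∑arr (length (a₁ ∷ R)) B (λ w → sign (inv (nonMaximaAfter j w)))
  term : ℕ → ℤ
  term j = term-on j ((a₀ ∷ a₁ ∷ R) ∖ j)
  a₁R! : Unique (a₁ ∷ R)
  a₁R! = strict⇒unique (a₁<R ∷ R↗)
  R! : Unique R
  R! = strict⇒unique R↗
  smallest : term a₀ ≡ S
  smallest = trans (cong (term-on a₀) (∖-head (All.map <⇒≢ (a₀<a₁ ∷ a₀<R))))
                   (∑arr-after-min (a₀<a₁ ∷ a₀<R) a₁R!)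
  second-smallest : term a₁ ≡ S
  second-smallest = trans (cong (term-on a₁) (trans (∖-skip (a₁ ∷ R) (<⇒≢ a₀<a₁))
                                                    (cong (a₀ ∷_) (∖-head (All.map <⇒≢ a₁<R)))))
                          (∑arr-after-second-min a₀<a₁ a₁<R a₁R!)
  larger : ∀ {j} → j ∈ R → term j ≡ 0ℤ
  larger {j} j∈R =
    trans (cong (term-on j) (trans (∖-skip (a₁ ∷ R) (<⇒≢ a₀<j)) (cong (a₀ ∷_) (∖-skip R (<⇒≢ a₁<j)))))
          (∑arr-after-larger a₀<a₁ a₁<j (All.filter⁺ _ a₁<R) (Unique.filter⁺ _ R!)
                             (cong suc (sym (↭-length (∖-↭ R! j∈R)))))
    where
    a₀<j : a₀ < j
    a₀<j = All.lookup a₀<R j∈R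
    a₁<j : a₁ < j
    a₁<j = All.lookup a₁<R j∈R

signedSum-increasing : ∀ A → AllPairs _<_ A → signedSum A ≡ pos (aSeq (length A))
signedSum-increasing []            _ = refl
signedSum-increasing (a ∷ [])      _ = refl
signedSum-increasing (a₀ ∷ a₁ ∷ R) A↗@(_ ∷ R₁↗) = begin
  signedSum (a₀ ∷ a₁ ∷ R)                   ≡⟨ signedSum-doubles A↗ ⟩
  signedSum (a₁ ∷ R) +ℤ signedSum (a₁ ∷ R)  ≡⟨ cong₂ _+ℤ_ IH IH ⟩
  pos (2 ^ length R + 2 ^ length R)         ≡⟨ cong (λ m → pos (2 ^ length R + m)) (+-identityʳ _) ⟨
  pos (aSeq (length (a₀ ∷ a₁ ∷ R)))         ∎
  where
  IH : signedSum (a₁ ∷ R) ≡ pos (2 ^ length R)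
  IH = signedSum-increasing (a₁ ∷ R) R₁↗

genPoly-at-−1 : ∀ n → genPoly (allPerms n) Stat123 -1ℤ ≡ pos (aSeq n)
genPoly-at-−1 n = begin
  ∑[ σ ∈ allPerms n ] sign (Stat123 σ)
    ≡⟨ ∑-allPerms n (λ w → sign (inv w ∸ inv (Φ321 w))) ⟩
  ∑[ v ∈ words n n ] (if isPerm v then sign (inv (word v) ∸ inv (Φ321 (word v))) else 0ℤ)
    ≡⟨ ∑-cong (words n n) (λ {v} _ → cong₂ (λ b z → if b then z else 0ℤ)
         (distinct≡fresh (toList v)) (cong sign (inv∸inv-Φ321≡inv-nonMaxima (word v)))) ⟩
  ∑[ v ∈ words n n ] (if fresh [] (word v) then sign (inv (nonMaxima (word v))) else 0ℤ)
    ≡⟨ ∑-words n n [] (λ w → sign (inv (nonMaxima w))) ⟩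
  ∑arr n (available n []) (λ w → sign (inv (nonMaxima w)))
    ≡⟨ cong₂ (λ k A → ∑arr k A (λ w → sign (inv (nonMaxima w)))) (length-upTo n) (available-[] n) ⟨
  signedSum (upTo n)
    ≡⟨ signedSum-increasing (upTo n) (AllPairs.applyUpTo⁺₁ id n (λ i<j _ → i<j)) ⟩
  pos (aSeq (length (upTo n)))
    ≡⟨ cong (pos ∘ aSeq) (length-upTo n) ⟩
  pos (aSeq n) ∎

theorem3p13 : ExhibitsCSPInv Stat123 aSeq
theorem3p13 n φ _ fixed = genPoly-at-1 (allPerms n) Stat123 , trans (genPoly-at-−1 n) (cong pos (sym fixed))
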